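{- Let $r\ge1$ and $\delta\ge1$ be integers, and let $H$ be a non-empty $r$-uniform hypergraph with $\delta^*(H)\ge\delta$. Then $|\partial_{r-1}(H)|\ge\binom{r+\delta-1}{r-1}$.
   Context: An $r$-uniform hypergraph $H$ has finite vertex set $V(H)$ and edge set $E(H)\subseteq\binom{V(H)}{r}$. For $0\le m\le r$, the $m$-shadow $\partial_m(H)$ is the set of $m$-element sets contained in some edge of $H$. For $U\subseteq V(H)$, $L_H(U)=\{e\setminus U: e\in E(H), U\subseteq e\}$, and for non-empty $H$, $\delta^*(H)=\min\{|L_H(U)|: U\in\binom{V(H)}{r-1},\ |L_H(U)|\neq0\}$. -}

module Defs where

open import Data.Nat using (ℕ; zero; suc; _≤_; _∸_; _+_)
open import Data.Bool using (Bool; true; false)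
open import Data.Fin.Subset using (Subset; _⊆_; _─_; ∣_∣; inside; outside)
open import Data.Fin.Subset.Properties using (_⊆?_)
open import Data.Vec using (_∷_; [])
open import Data.List using (List; []; _∷_; map; _++_; filter; length)
open import Data.List.Membership.Propositional using (_∈_)
open import Data.List.Relation.Unary.Any using (any?)
open import Data.Product using (Σ; ∃; _×_; _,_)
open import Relation.Nullary using (Dec; ¬_; yes; no)
open import Relation.Nullary.Decidable using (_×-dec_)
open import Relation.Unary using (Decidable)
open import Relation.Binary.PropositionalEquality using (_≡_)
open import Data.Bool.Properties using () renaming (_≟_ to _≟B_)
open import Data.Vec.Properties using (≡-dec)
open import Data.List.Membership.Propositional using (lose)
open import Data.List.Membership.Propositional.Properties using (∈-map⁺; ∈-++⁺ˡ; ∈-++⁺ʳ)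
open import Data.List.Relation.Unary.Any using (Any; here; there; satisfied)
open import Data.Nat using (_⊓_; _≟_)
open import Relation.Binary.PropositionalEquality using (refl)

-- Hypergraphs on the vertex set Fin n (any finite vertex set is, up to
-- relabelling, of this form).  A subset of Fin n is a 'Subset n'.

allSubsets : (n : ℕ) → List (Subset n)
allSubsets zero    = [] ∷ []
allSubsets (suc n) = map (outside ∷_) (allSubsets n) ++ map (inside ∷_) (allSubsets n)

allSubsets-complete : {n : ℕ} (s : Subset n) → s ∈ allSubsets n
allSubsets-complete []              = here refl
allSubsets-complete {suc n} (outside ∷ s) = ∈-++⁺ˡ (∈-map⁺ _ (allSubsets-complete s))
allSubsets-complete {suc n} (inside ∷ s)  = ∈-++⁺ʳ (map (outside ∷_) (allSubsets n)) (∈-map⁺ _ (allSubsets-complete s))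

∃S? : {n : ℕ} {Q : Subset n → Set} → Decidable Q → Dec (∃ Q)
∃S? {n} Q? with any? Q? (allSubsets n)
... | yes a = yes (satisfied a)
... | no ¬a = no λ { (e , q) → ¬a (lose (allSubsets-complete e) q) }

card : {n : ℕ} {P : Subset n → Set} → Decidable P → ℕ
card {n} P? = length (filter P? (allSubsets n))

_≟S_ : {n : ℕ} (a b : Subset n) → Dec (a ≡ b)
_≟S_ = ≡-dec _≟B_

record Hypergraph (n r : ℕ) : Set where
  field
    edge    : Subset n → Bool
    uniform : ∀ e → edge e ≡ true → ∣ e ∣ ≡ r
open Hypergraph public

IsEdge : {n r : ℕ} → Hypergraph n r → Subset n → Set
IsEdge H e = edge H e ≡ true

isEdge? : {n r : ℕ} (H : Hypergraph n r) → Decidable (IsEdge H)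
isEdge? H e = edge H e ≟B true

NonEmpty : {n r : ℕ} → Hypergraph n r → Set
NonEmpty {n} H = ∃ λ e → IsEdge H e

InShadow : {n r : ℕ} → Hypergraph n r → ℕ → Subset n → Set
InShadow H m S = (∣ S ∣ ≡ m) × (∃ λ e → IsEdge H e × S ⊆ e)

inShadow? : {n r : ℕ} (H : Hypergraph n r) (m : ℕ) → Decidable (InShadow H m)
inShadow? H m S = (∣ S ∣ ≟ m) ×-dec ∃S? (λ e → isEdge? H e ×-dec (S ⊆? e))

shadowSize : {n r : ℕ} → Hypergraph n r → ℕ → ℕ
shadowSize H m = card (inShadow? H m)

InLink : {n r : ℕ} → Hypergraph n r → Subset n → Subset n → Set
InLink H U T = ∃ λ e → IsEdge H e × U ⊆ e × T ≡ e ─ U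

inLink? : {n r : ℕ} (H : Hypergraph n r) (U : Subset n) → Decidable (InLink H U)
inLink? H U T = ∃S? (λ e → isEdge? H e ×-dec ((U ⊆? e) ×-dec (T ≟S (e ─ U))))

linkSize : {n r : ℕ} → Hypergraph n r → Subset n → ℕ
linkSize H U = card (inLink? H U)

NonEmptyLink : {n r : ℕ} → Hypergraph n r → Subset n → Set
NonEmptyLink {r = r} H U = (∣ U ∣ ≡ r ∸ 1) × ¬ (linkSize H U ≡ 0)

nonEmptyLink? : {n r : ℕ} (H : Hypergraph n r) → Decidable (NonEmptyLink H)
nonEmptyLink? {r = r} H U with ∣ U ∣ ≟ r ∸ 1 | linkSize H U ≟ 0
... | yes p | no q  = yes (p , q)
... | yes p | yes q = no λ { (_ , q') → q' q }
... | no p  | _     = no λ { (p' , _) → p p' }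

-- Minimum of a list of naturals (only used on non-empty lists).
minimum : List ℕ → ℕ
minimum []       = 0
minimum (x ∷ []) = x
minimum (x ∷ xs) = x ⊓ minimum xs

δ* : {n r : ℕ} → Hypergraph n r → ℕ
δ* {n} H = minimum (map (linkSize H) (filter (nonEmptyLink? H) (allSubsets n)))

{-# OPTIONS --safe #-}
module Submission where

-- Split off vertex 0: the edges avoiding it form delete₀ H, and the traces of
-- the edges through it form link₀ H, an (r-1)-uniform hypergraph whose
-- codegrees are at least those of H.  In delete₀ H codegrees drop by at most
-- one, since the only possible link element through 0 of an (r-1)-set
-- avoiding 0 is {0}.  Induction on the number of vertices together with
-- Pascal's rule then gives |E(H)| ≥ C(r-1+δ, r), counting edges through 0 via
-- link₀ H and the others via delete₀ H, and the shadow bound, counting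
-- (r-1)-sets through 0 via the shadow of link₀ H and those avoiding 0 via the
-- edges of link₀ H.

open import Defs
open import Data.Nat using (ℕ; zero; suc; z≤n; s≤s; s≤s⁻¹; _<_; _≤_; _+_; _∸_)
open import Data.Nat.Properties
  using (≤-refl; ≤-trans; ≤-reflexive; <-irrefl; <⇒≱; suc-injective; n>0⇒n≢0; m≤m+n;
         m⊓n≤m; m⊓n≤n; +-comm; +-suc; +-identityʳ; +-mono-≤; +-monoʳ-≤; module ≤-Reasoning)
open import Data.Nat.Combinatorics using (_C_; nC1≡n; nCk+nC[k+1]≡[n+1]C[k+1]; k>n⇒nCk≡0)
open import Data.Bool using (Bool; true; false)
open import Data.Vec using ([]; _∷_)
import Data.Vec as Vec
open import Data.Vec.Properties using (∷-injectiveˡ; ∷-injectiveʳ)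
open import Data.List using (List; []; _∷_; map; _++_; filter; length)
open import Data.List.Properties using (length-++; length-map; filter-++; length-filter; filter-some; filter-none)
open import Data.List.Membership.Propositional using (lose) renaming (_∈_ to _∈ₗ_)
open import Data.List.Membership.Propositional.Properties using (∈-map⁺; ∈-filter⁺)
open import Data.List.Relation.Unary.Any using (here; there)
import Data.List.Relation.Unary.All as All
import Data.List.Relation.Binary.Sublist.Propositional as Sublist
open import Data.List.Relation.Binary.Sublist.Propositional.Properties using (filter⁺; length-mono-≤)
open import Data.Fin.Subset using (Subset; _⊆_; _─_; ∣_∣; inside; outside; ⊥)
open import Data.Fin.Subset.Properties using (drop-∷-⊆; out⊆; s⊆s; ⊥⊆; ∣⊥∣≡0; p─⊥≡p; ⊆-refl; p⊆q⇒∣p∣≤∣q∣)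
open import Data.Product using (∃; _,_)
open import Data.Empty using (⊥-elim)
open import Function using (_∘_)
open import Level using (Level; 0ℓ)
open import Relation.Nullary using (¬_; does; yes; no; contradiction)
open import Relation.Unary using (Pred; Decidable)
open import Relation.Binary.PropositionalEquality using (_≡_; _≢_; refl; cong; cong₂; sym; trans; subst; module ≡-Reasoning)

private
  variable
    a b p : Level
    A : Set a
    B : Set b
    n r s t d δ : ℕ

filter-map : {P : Pred B p} (P? : Decidable P) (f : A → B) (xs : List A) →
             filter P? (map f xs) ≡ map f (filter (P? ∘ f) xs)
filter-map P? f []       = refl
filter-map P? f (x ∷ xs) with does (P? (f x))
... | true  = cong (f x ∷_) (filter-map P? f xs)
... | false = filter-map P? f xs

module _ {P : Pred (Subset n) 0ℓ} (P? : Decidable P) where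

  card-some : ∀ {s} → P s → 0 < card P?
  card-some {s} ps = filter-some P? (lose (allSubsets-complete s) ps)

  card-none : (∀ s → ¬ P s) → card P? ≡ 0
  card-none ¬P = cong length (filter-none P? {allSubsets n} (All.tabulate λ {s} _ → ¬P s))

  card>0⇒∃ : 0 < card P? → ∃ P
  card>0⇒∃ card>0 with ∃S? P?
  ... | yes ∃P = ∃P
  ... | no  ∄P = contradiction card>0 (<-irrefl (sym (card-none λ s ps → ∄P (s , ps))))

  card-mono : {Q : Pred (Subset n) 0ℓ} (Q? : Decidable Q) → (∀ {s} → P s → Q s) → card P? ≤ card Q?
  card-mono Q? P⇒Q = length-mono-≤ (filter⁺ P? Q? (λ { refl → P⇒Q }) (Sublist.⊆-refl {x = allSubsets n}))

card-∷ : {P : Pred (Subset (suc n)) 0ℓ} (P? : Decidable P) →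
         card P? ≡ card (P? ∘ (outside ∷_)) + card (P? ∘ (inside ∷_))
card-∷ {n} P? = begin
  length (filter P? (map (outside ∷_) Sₙ ++ map (inside ∷_) Sₙ))
    ≡⟨ cong length (filter-++ P? (map (outside ∷_) Sₙ) _) ⟩
  length (filter P? (map (outside ∷_) Sₙ) ++ filter P? (map (inside ∷_) Sₙ))
    ≡⟨ length-++ (filter P? (map (outside ∷_) Sₙ)) ⟩
  length (filter P? (map (outside ∷_) Sₙ)) + length (filter P? (map (inside ∷_) Sₙ))
    ≡⟨ cong₂ _+_ (length-filter-map (outside ∷_)) (length-filter-map (inside ∷_)) ⟩
  card (P? ∘ (outside ∷_)) + card (P? ∘ (inside ∷_)) ∎
  where
  open ≡-Reasoning
  Sₙ = allSubsets n
  length-filter-map : ∀ f → length (filter P? (map f Sₙ)) ≡ length (filter (P? ∘ f) Sₙ)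
  length-filter-map f = trans (cong length (filter-map P? f Sₙ)) (length-map f (filter (P? ∘ f) Sₙ))

card-∷-fixed-head : {P : Pred (Subset (suc n)) 0ℓ} (P? : Decidable P) (x : Bool) →
                    (∀ {x′ s} → P (x′ ∷ s) → x′ ≡ x) → card P? ≡ card (P? ∘ (x ∷_))
card-∷-fixed-head P? outside P⇒x = trans (card-∷ P?)
  (trans (cong (card (P? ∘ (outside ∷_)) +_) (card-none (P? ∘ (inside ∷_)) λ s → (λ ()) ∘ P⇒x))
         (+-identityʳ _))
card-∷-fixed-head P? inside P⇒x = trans (card-∷ P?)
  (cong (_+ card (P? ∘ (inside ∷_))) (card-none (P? ∘ (outside ∷_)) λ s → (λ ()) ∘ P⇒x))

card≤1 : {P : Pred (Subset n) 0ℓ} (P? : Decidable P) (x : Subset n) → (∀ {s} → P s → s ≡ x) → card P? ≤ 1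
card≤1 {zero}  P? [] _ = length-filter P? (allSubsets 0)
card≤1 {suc n} P? (x ∷ xs) P⇒≡ = ≤-trans
  (≤-reflexive (card-∷-fixed-head P? x (∷-injectiveˡ ∘ P⇒≡)))
  (card≤1 (P? ∘ (x ∷_)) xs (∷-injectiveʳ ∘ P⇒≡))

p⊆q∧∣q∣≤∣p∣⇒p≡q : ∀ {p q : Subset n} → p ⊆ q → ∣ q ∣ ≤ ∣ p ∣ → p ≡ q
p⊆q∧∣q∣≤∣p∣⇒p≡q {p = []}          {[]}          _   _     = refl
p⊆q∧∣q∣≤∣p∣⇒p≡q {p = outside ∷ p} {outside ∷ q} p⊆q ∣q∣≤∣p∣ =
  cong (outside ∷_) (p⊆q∧∣q∣≤∣p∣⇒p≡q (drop-∷-⊆ p⊆q) ∣q∣≤∣p∣)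
p⊆q∧∣q∣≤∣p∣⇒p≡q {p = inside ∷ p}  {inside ∷ q}  p⊆q ∣q∣≤∣p∣ =
  cong (inside ∷_) (p⊆q∧∣q∣≤∣p∣⇒p≡q (drop-∷-⊆ p⊆q) (s≤s⁻¹ ∣q∣≤∣p∣))
p⊆q∧∣q∣≤∣p∣⇒p≡q {p = inside ∷ p}  {outside ∷ q} p⊆q _     = contradiction (p⊆q Vec.here) λ ()
p⊆q∧∣q∣≤∣p∣⇒p≡q {p = outside ∷ p} {inside ∷ q}  p⊆q ∣q∣≤∣p∣ =
  contradiction (p⊆q⇒∣p∣≤∣q∣ (drop-∷-⊆ p⊆q)) (<⇒≱ ∣q∣≤∣p∣)

delete₀ : Hypergraph (suc n) r → Hypergraph n r
delete₀ G = record { edge = edge G ∘ (outside ∷_) ; uniform = uniform G ∘ (outside ∷_) }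

link₀ : Hypergraph (suc n) (suc r) → Hypergraph n r
link₀ G = record { edge = edge G ∘ (inside ∷_) ; uniform = λ e → suc-injective ∘ uniform G (inside ∷ e) }

edgeCount : Hypergraph n r → ℕ
edgeCount G = card (isEdge? G)

-- δ ≤ δ*(G), as an (r-1)-set has non-empty link exactly when it lies in an edge.
MinCodegree≥ : Hypergraph n (suc s) → ℕ → Set
MinCodegree≥ {s = s} G δ = ∀ {e U} → IsEdge G e → U ⊆ e → ∣ U ∣ ≡ s → δ ≤ linkSize G U

linkSize-inside : (G : Hypergraph (suc n) (suc r)) (U : Subset n) →
                  linkSize G (inside ∷ U) ≤ linkSize (link₀ G) U
linkSize-inside G U = ≤-trans
  (≤-reflexive (card-∷-fixed-head (inLink? G (inside ∷ U)) outside λ { (_ ∷ _ , _ , _ , refl) → refl }))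
  (card-mono _ (inLink? (link₀ G) U) λ where
    (outside ∷ e , e∈ , U⊆e , T≡) → contradiction (U⊆e Vec.here) λ ()
    (inside ∷ e , e∈ , U⊆e , T≡) → e , e∈ , drop-∷-⊆ U⊆e , ∷-injectiveʳ T≡)

linkSize-outside : (G : Hypergraph (suc n) (suc r)) (U : Subset n) →
                   linkSize G (outside ∷ U) ≤ linkSize (delete₀ G) U + linkSize (link₀ G) U
linkSize-outside G U = begin
  linkSize G (outside ∷ U)
    ≡⟨ card-∷ (inLink? G (outside ∷ U)) ⟩
  card (inLink? G (outside ∷ U) ∘ (outside ∷_)) + card (inLink? G (outside ∷ U) ∘ (inside ∷_))
    ≤⟨ +-mono-≤ (card-mono _ (inLink? (delete₀ G) U) λ where
                   (outside ∷ e , e∈ , U⊆e , T≡) → e , e∈ , drop-∷-⊆ U⊆e , ∷-injectiveʳ T≡)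
                (card-mono _ (inLink? (link₀ G) U) λ where
                   (inside ∷ e , e∈ , U⊆e , T≡) → e , e∈ , drop-∷-⊆ U⊆e , ∷-injectiveʳ T≡) ⟩
  linkSize (delete₀ G) U + linkSize (link₀ G) U ∎
  where open ≤-Reasoning

∣U∣≡r⇒linkSize≤1 : (G : Hypergraph n r) (U : Subset n) → ∣ U ∣ ≡ r → linkSize G U ≤ 1
∣U∣≡r⇒linkSize≤1 G U ∣U∣≡r = card≤1 (inLink? G U) (U ─ U) λ where
  (e , e∈ , U⊆e , refl) → cong (_─ U) (sym (p⊆q∧∣q∣≤∣p∣⇒p≡q U⊆e (≤-reflexive (trans (uniform G e e∈) (sym ∣U∣≡r)))))

link₀-minCodegree≥ : (G : Hypergraph (suc n) (suc (suc s))) → MinCodegree≥ G δ → MinCodegree≥ (link₀ G) δ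
link₀-minCodegree≥ G cod e∈ U⊆e ∣U∣ = ≤-trans (cod e∈ (s⊆s U⊆e) (cong suc ∣U∣)) (linkSize-inside G _)

delete₀-minCodegree≥ : (G : Hypergraph (suc n) (suc s)) → ¬ NonEmpty (link₀ G) →
                       MinCodegree≥ G δ → MinCodegree≥ (delete₀ G) δ
delete₀-minCodegree≥ G ¬ne₁ cod {U = U} e∈ U⊆e ∣U∣ = begin
  _                                             ≤⟨ cod e∈ (out⊆ U⊆e) ∣U∣ ⟩
  linkSize G (outside ∷ U)                      ≤⟨ linkSize-outside G U ⟩
  linkSize (delete₀ G) U + linkSize (link₀ G) U ≡⟨ cong (linkSize (delete₀ G) U +_) link₀-linkSize≡0 ⟩
  linkSize (delete₀ G) U + 0                    ≡⟨ +-identityʳ _ ⟩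
  linkSize (delete₀ G) U                        ∎
  where
  open ≤-Reasoning
  link₀-linkSize≡0 : linkSize (link₀ G) U ≡ 0
  link₀-linkSize≡0 = card-none (inLink? (link₀ G) U) λ { _ (e , e∈ , _) → ¬ne₁ (e , e∈) }

delete₀-linkSize≥ : (G : Hypergraph (suc n) (suc s)) → MinCodegree≥ G (suc δ) →
                    ∀ {e U} → IsEdge G e → outside ∷ U ⊆ e → ∣ U ∣ ≡ s → δ ≤ linkSize (delete₀ G) U
delete₀-linkSize≥ G cod {U = U} e∈ U⊆e ∣U∣ = s≤s⁻¹ (begin
  _                                             ≤⟨ cod e∈ U⊆e ∣U∣ ⟩
  linkSize G (outside ∷ U)                      ≤⟨ linkSize-outside G U ⟩
  linkSize (delete₀ G) U + linkSize (link₀ G) U ≤⟨ +-monoʳ-≤ _ (∣U∣≡r⇒linkSize≤1 (link₀ G) U ∣U∣) ⟩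
  linkSize (delete₀ G) U + 1                    ≡⟨ +-comm _ 1 ⟩
  suc (linkSize (delete₀ G) U)                  ∎)
  where open ≤-Reasoning

delete₀-minCodegree≥-pred : (G : Hypergraph (suc n) (suc s)) → MinCodegree≥ G (suc δ) → MinCodegree≥ (delete₀ G) δ
delete₀-minCodegree≥-pred G cod {e} e∈ U⊆e = delete₀-linkSize≥ G cod {outside ∷ e} e∈ (out⊆ U⊆e)

delete₀-nonEmpty : (G : Hypergraph (suc n) (suc r)) → ¬ NonEmpty (link₀ G) → NonEmpty G → NonEmpty (delete₀ G)
delete₀-nonEmpty G ¬ne₁ (outside ∷ e , e∈) = e , e∈
delete₀-nonEmpty G ¬ne₁ (inside ∷ e , e∈)  = ⊥-elim (¬ne₁ (e , e∈))

delete₀-nonEmpty-pred : (G : Hypergraph (suc n) (suc s)) → MinCodegree≥ G (suc (suc δ)) →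
                        NonEmpty (link₀ G) → NonEmpty (delete₀ G)
delete₀-nonEmpty-pred G cod (e , e∈) with card>0⇒∃ (inLink? (delete₀ G) e)
  (≤-trans (s≤s z≤n) (delete₀-linkSize≥ G cod {inside ∷ e} e∈ (out⊆ ⊆-refl) (uniform (link₀ G) e e∈)))
... | _ , e′ , e′∈ , _ = e′ , e′∈

edgeCount-∷ : (G : Hypergraph (suc n) (suc r)) → edgeCount G ≡ edgeCount (delete₀ G) + edgeCount (link₀ G)
edgeCount-∷ G = card-∷ (isEdge? G)

edgeCount-bound : (G : Hypergraph n (suc s)) → NonEmpty G → MinCodegree≥ G (suc d) →
                  (s + suc d) C suc s ≤ edgeCount G
edgeCount-bound {n} {zero} {d} G (e , e∈) cod = begin
  suc d C 1    ≡⟨ nC1≡n (suc d) ⟩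
  suc d        ≤⟨ cod e∈ ⊥⊆ (∣⊥∣≡0 n) ⟩
  linkSize G ⊥ ≤⟨ card-mono (inLink? G ⊥) (isEdge? G) (λ { (e , e∈ , _ , refl) → subst (IsEdge G) (sym (p─⊥≡p e)) e∈ }) ⟩
  edgeCount G  ∎
  where open ≤-Reasoning
edgeCount-bound {zero} {suc s} G ([] , e∈) _ = contradiction (uniform G [] e∈) λ ()
edgeCount-bound {suc n} {suc s} {d} G ne cod with ∃S? (isEdge? (link₀ G))
... | no ¬ne₁ = begin
  (suc s + suc d) C suc (suc s)               ≤⟨ edgeCount-bound (delete₀ G) (delete₀-nonEmpty G ¬ne₁ ne)
                                                                 (delete₀-minCodegree≥ G ¬ne₁ cod) ⟩
  edgeCount (delete₀ G)                       ≤⟨ m≤m+n _ _ ⟩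
  edgeCount (delete₀ G) + edgeCount (link₀ G) ≡⟨ edgeCount-∷ G ⟨
  edgeCount G                                 ∎
  where open ≤-Reasoning
... | yes ne₁ = begin
  (suc s + suc d) C suc (suc s)                     ≡⟨ nCk+nC[k+1]≡[n+1]C[k+1] (s + suc d) (suc s) ⟨
  (s + suc d) C suc s + (s + suc d) C suc (suc s)   ≤⟨ +-mono-≤ (edgeCount-bound (link₀ G) ne₁ (link₀-minCodegree≥ G cod))
                                                               (delete₀-bound d cod) ⟩
  edgeCount (link₀ G) + edgeCount (delete₀ G)       ≡⟨ +-comm (edgeCount (link₀ G)) _ ⟩
  edgeCount (delete₀ G) + edgeCount (link₀ G)       ≡⟨ edgeCount-∷ G ⟨
  edgeCount G                                       ∎
  where
  open ≤-Reasoning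
  delete₀-bound : ∀ d′ → MinCodegree≥ G (suc d′) → (s + suc d′) C suc (suc s) ≤ edgeCount (delete₀ G)
  delete₀-bound zero _ = ≤-trans (≤-reflexive (k>n⇒nCk≡0 (s≤s (≤-reflexive (+-comm s 1))))) z≤n
  delete₀-bound (suc d′) cod′ = subst (λ m → m C suc (suc s) ≤ edgeCount (delete₀ G)) (sym (+-suc s (suc d′)))
    (edgeCount-bound (delete₀ G) (delete₀-nonEmpty-pred G cod′ ne₁) (delete₀-minCodegree≥-pred G cod′))

shadowSize-delete₀ : (G : Hypergraph (suc n) r) (m : ℕ) → shadowSize (delete₀ G) m ≤ shadowSize G m
shadowSize-delete₀ G m = begin
  shadowSize (delete₀ G) m
    ≤⟨ card-mono (inShadow? (delete₀ G) m) (inShadow? G m ∘ (outside ∷_))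
                 (λ { (∣S∣ , e , e∈ , S⊆e) → ∣S∣ , outside ∷ e , e∈ , s⊆s S⊆e }) ⟩
  card (inShadow? G m ∘ (outside ∷_))
    ≤⟨ m≤m+n _ _ ⟩
  card (inShadow? G m ∘ (outside ∷_)) + card (inShadow? G m ∘ (inside ∷_))
    ≡⟨ card-∷ (inShadow? G m) ⟨
  shadowSize G m ∎
  where open ≤-Reasoning

shadowSize-link₀ : (G : Hypergraph (suc n) (suc (suc t))) →
                   shadowSize (link₀ G) t + edgeCount (link₀ G) ≤ shadowSize G (suc t)
shadowSize-link₀ {t = t} G = begin
  shadowSize (link₀ G) t + edgeCount (link₀ G)
    ≤⟨ +-mono-≤ (card-mono (inShadow? (link₀ G) t) (inShadow? G (suc t) ∘ (inside ∷_))
                           (λ { (∣S∣ , e , e∈ , S⊆e) → cong suc ∣S∣ , inside ∷ e , e∈ , s⊆s S⊆e }))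
                (card-mono (isEdge? (link₀ G)) (inShadow? G (suc t) ∘ (outside ∷_))
                           (λ {S} S∈ → uniform (link₀ G) S S∈ , inside ∷ S , S∈ , out⊆ ⊆-refl)) ⟩
  card (inShadow? G (suc t) ∘ (inside ∷_)) + card (inShadow? G (suc t) ∘ (outside ∷_))
    ≡⟨ +-comm (card (inShadow? G (suc t) ∘ (inside ∷_))) _ ⟩
  card (inShadow? G (suc t) ∘ (outside ∷_)) + card (inShadow? G (suc t) ∘ (inside ∷_))
    ≡⟨ card-∷ (inShadow? G (suc t)) ⟨
  shadowSize G (suc t) ∎
  where open ≤-Reasoning

shadowSize-bound : (G : Hypergraph n (suc t)) → NonEmpty G → MinCodegree≥ G (suc d) →
                   (t + suc d) C t ≤ shadowSize G t
shadowSize-bound {n} {zero} G (e , e∈) _ = card-some (inShadow? G 0) (∣⊥∣≡0 n , e , e∈ , ⊥⊆)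
shadowSize-bound {zero} {suc t} G ([] , e∈) _ = contradiction (uniform G [] e∈) λ ()
shadowSize-bound {suc n} {suc t} {d} G ne cod with ∃S? (isEdge? (link₀ G))
... | no ¬ne₁ = ≤-trans
  (shadowSize-bound (delete₀ G) (delete₀-nonEmpty G ¬ne₁ ne) (delete₀-minCodegree≥ G ¬ne₁ cod))
  (shadowSize-delete₀ G (suc t))
... | yes ne₁ = begin
  (suc t + suc d) C suc t                      ≡⟨ nCk+nC[k+1]≡[n+1]C[k+1] (t + suc d) t ⟨
  (t + suc d) C t + (t + suc d) C suc t        ≤⟨ +-mono-≤ (shadowSize-bound (link₀ G) ne₁ cod₁)
                                                           (edgeCount-bound (link₀ G) ne₁ cod₁) ⟩
  shadowSize (link₀ G) t + edgeCount (link₀ G) ≤⟨ shadowSize-link₀ G ⟩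
  shadowSize G (suc t)                         ∎
  where
  open ≤-Reasoning
  cod₁ : MinCodegree≥ (link₀ G) (suc d)
  cod₁ = link₀-minCodegree≥ G cod

minimum-≤ : ∀ {x xs} → x ∈ₗ xs → minimum xs ≤ x
minimum-≤ {xs = x ∷ []}     (here refl) = ≤-refl
minimum-≤ {xs = x ∷ y ∷ ys} (here refl) = m⊓n≤m x (minimum (y ∷ ys))
minimum-≤ {xs = x ∷ y ∷ ys} (there x∈) = ≤-trans (m⊓n≤n x (minimum (y ∷ ys))) (minimum-≤ x∈)

δ≤δ*⇒minCodegree≥ : (H : Hypergraph n (suc s)) → δ ≤ δ* H → MinCodegree≥ H δ
δ≤δ*⇒minCodegree≥ H δ≤δ* {e} {U} e∈ U⊆e ∣U∣ = ≤-trans δ≤δ*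
  (minimum-≤ (∈-map⁺ (linkSize H) (∈-filter⁺ (nonEmptyLink? H) (allSubsets-complete U) (∣U∣ , linkSize≢0))))
  where
  linkSize≢0 : linkSize H U ≢ 0
  linkSize≢0 = n>0⇒n≢0 (card-some (inLink? H U) (e , e∈ , U⊆e , refl))

proposition6p5 : (n r δ : ℕ) → 1 ≤ r → 1 ≤ δ → (H : Hypergraph n r) → NonEmpty H → δ ≤ δ* H →
    (r + δ ∸ 1) C (r ∸ 1) ≤ shadowSize H (r ∸ 1)
proposition6p5 n (suc t) (suc d) (s≤s z≤n) (s≤s z≤n) H ne δ≤δ* =
  shadowSize-bound H ne (δ≤δ*⇒minCodegree≥ H δ≤δ*)
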